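{- Let $r\in\mathbb{N}\cup\{\infty\}$ and $k,k'\in\mathbb{N}$. For every graph $G$ and every $k'$-flip $G'$ of $G$, $\mathrm{frk}_{r,k\cdot k'}(G')\le\mathrm{frk}_{r,k}(G)$.
   Context: Graphs are finite, simple, undirected. $B^r_H(v)$ is the set of vertices at distance at most $r$ from $v$ in $H$; $H[X]$ is the induced subgraph. Flipping $(A,B)$ in $G$ yields the graph on $V(G)$ with edge set (on distinct pairs) $E(G)\triangle\{ab:a\in A,b\in B\}$. A $k$-flip of $G$ is obtained by flipping some pairs $(A,B)$ with $A,B\in\mathcal{P}$ (possibly $A=B$) for a partition $\mathcal{P}$ of $V(G)$ with $|\mathcal{P}|\le k$. Flipper-rank: $\mathrm{frk}_{r,k}(K_1)=1$ and for every other graph $G$, $\mathrm{frk}_{r,k}(G)=1+\min_H\max_{v\in V(H)}\mathrm{frk}_{r,k}(H[B^r_H(v)])$, the minimum over all $k$-flips $H$ of $G$. -}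

module Defs where

open import Data.Nat using (ℕ; zero; suc; _≤_)
open import Data.Fin using (Fin; _≟_)
open import Data.Bool using (Bool; true; false; not; _∧_; _∨_; _xor_)
open import Data.List using (List; foldr)
open import Data.Product using (Σ; _×_; _,_)
open import Data.Unit using (⊤)
open import Relation.Nullary.Decidable using (⌊_⌋)
open import Relation.Binary.PropositionalEquality using (_≡_)

Adj : ℕ → Set
Adj N = Fin N → Fin N → Bool

IsSimple : ∀ {N} → Adj N → Set
IsSimple {N} a = (∀ (u v : Fin N) → a u v ≡ a v u) × (∀ (u : Fin N) → a u u ≡ false)

-- A graph whose vertex set is a subset (predicate) of Fin N; edges are those
-- of the adjacency matrix between members (used to form induced subgraphs).
record SGraph (N : ℕ) : Set₁ where
  constructor sgraph
  field
    mem : Fin N → Set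
    adj : Adj N
open SGraph public

full : ∀ {N} → Adj N → SGraph N
full a = sgraph (λ _ → ⊤) a

flipPair : ∀ {N k} → (Fin N → Fin k) → Fin k × Fin k → Adj N → Adj N
flipPair part (i , j) a u v =
  a u v xor (not ⌊ u ≟ v ⌋ ∧ ((⌊ part u ≟ i ⌋ ∧ ⌊ part v ≟ j ⌋) ∨ (⌊ part v ≟ i ⌋ ∧ ⌊ part u ≟ j ⌋)))

flipAdj : ∀ {N k} → (Fin N → Fin k) → List (Fin k × Fin k) → Adj N → Adj N
flipAdj part ps a = foldr (flipPair part) a ps

flipG : ∀ {N k} → (Fin N → Fin k) → List (Fin k × Fin k) → SGraph N → SGraph N
flipG part ps H = sgraph (mem H) (flipAdj part ps (adj H))

data ℕ∞ : Set where
  fin : ℕ → ℕ∞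
  ∞   : ℕ∞

data Walk {N} (H : SGraph N) : Fin N → Fin N → ℕ → Set where
  nil  : ∀ {u} → mem H u → Walk H u u 0
  cons : ∀ {u w v l} → mem H u → adj H u w ≡ true → Walk H w v l → Walk H u v (suc l)

_≤∞_ : ℕ → ℕ∞ → Set
l ≤∞ fin r = l ≤ r
l ≤∞ ∞     = ⊤

InBall : ∀ {N} → ℕ∞ → SGraph N → Fin N → Fin N → Set
InBall r H v u = Σ ℕ λ l → Walk H v u l × (l ≤∞ r)

ball : ∀ {N} → ℕ∞ → SGraph N → Fin N → SGraph N
ball r H v = sgraph (InBall r H v) (adj H)

IsK1 : ∀ {N} → SGraph N → Set
IsK1 {N} H = Σ (Fin N) λ v → mem H v × (∀ u → mem H u → u ≡ v)

-- FrkLe r k n H  ⇔  frk_{r,k}(H) ≤ n   (frk takes values in ℕ ∪ {∞}).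
-- A k-flip is given by a map part : V → Fin k (a partition into ≤ k parts)
-- and a list of pairs of parts to flip.
data FrkLe (r : ℕ∞) (k : ℕ) {N : ℕ} : ℕ → SGraph N → Set₁ where
  base : ∀ {n H} → IsK1 H → FrkLe r k (suc n) H
  step : ∀ {n H} (part : Fin N → Fin k) (ps : List (Fin k × Fin k)) →
         (∀ v → mem H v → FrkLe r k n (ball r (flipG part ps H) v)) →
         FrkLe r k (suc n) H

-- Flips compose: a k-flip H of G and a k′-flip G′ of G differ by a toggle pattern that is
-- constant on the parts of the common refinement of the two partitions, and every symmetric
-- toggle pattern between parts is realised by flipping some list of pairs of parts. Hence H
-- is a (k·k′)-flip of G′, so the first round of a flipper strategy for G can be played on G′
-- and reaches the same graph; the later rounds only re-index their parts into Fin (k·k′).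
module Submission where

open import Defs
open import Data.Nat using (ℕ; zero; suc; _*_)
open import Data.Fin using (Fin; zero; suc; _≟_; combine; remQuot)
open import Data.Fin.Properties using (suc-injective; combine-injectiveˡ; remQuot-combine)
open import Data.List using (List; []; _∷_; _++_; map; filterᵇ; allFin)
open import Data.List.Properties using (map-tabulate)
open import Data.Product using (Σ; _×_; _,_; proj₁; proj₂)
import Data.Product as Product
open import Data.Bool using (Bool; true; false; not; _∧_; _∨_; _xor_)
open import Data.Bool.Properties
  using ( xor-assoc; xor-comm; xor-same; xor-identityʳ; ∧-zeroʳ; ∧-identityʳ; ∧-distribˡ-xor
        ; ∨-comm; ∨-idem; ∨-identityʳ )
open import Data.Unit using (tt)
open import Function using (_∘_)
open import Function.Bundles using (mk⇔)
open import Function.Definitions using (Injective)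
open import Relation.Nullary.Decidable using (⌊_⌋; isYes≗does; does-⇔)
open import Relation.Binary.PropositionalEquality

xor-cancelˡ : ∀ x y → x xor (x xor y) ≡ y
xor-cancelˡ x y = trans (sym (xor-assoc x x y)) (cong (_xor y) (xor-same x))

xor-∧-merge : ∀ a c s t → (a xor (c ∧ s)) xor (c ∧ t) ≡ a xor (c ∧ (s xor t))
xor-∧-merge a c s t = trans (xor-assoc a (c ∧ s) (c ∧ t)) (cong (a xor_) (sym (∧-distribˡ-xor c s t)))

xorSum : ∀ {A : Set} → List A → (A → Bool) → Bool
xorSum []       f = false
xorSum (x ∷ xs) f = f x xor xorSum xs f

module _ {A : Set} where

  xorSum-++ : ∀ (xs ys : List A) f → xorSum (xs ++ ys) f ≡ xorSum xs f xor xorSum ys f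
  xorSum-++ []       ys f = refl
  xorSum-++ (x ∷ xs) ys f = trans (cong (f x xor_) (xorSum-++ xs ys f)) (sym (xor-assoc (f x) _ _))

  xorSum-map : ∀ {B : Set} (g : A → B) xs f → xorSum (map g xs) f ≡ xorSum xs (f ∘ g)
  xorSum-map g []       f = refl
  xorSum-map g (x ∷ xs) f = cong (f (g x) xor_) (xorSum-map g xs f)

  xorSum-cong : ∀ xs {f g : A → Bool} → (∀ x → f x ≡ g x) → xorSum xs f ≡ xorSum xs g
  xorSum-cong []       f≗g = refl
  xorSum-cong (x ∷ xs) f≗g = cong₂ _xor_ (f≗g x) (xorSum-cong xs f≗g)

  xorSum-false : ∀ xs {f : A → Bool} → (∀ x → f x ≡ false) → xorSum xs f ≡ false
  xorSum-false []       f≗false = refl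
  xorSum-false (x ∷ xs) f≗false rewrite f≗false x = xorSum-false xs f≗false

  xorSum-filterᵇ : ∀ (p : A → Bool) xs f → xorSum (filterᵇ p xs) f ≡ xorSum xs (λ x → p x ∧ f x)
  xorSum-filterᵇ p []       f = refl
  xorSum-filterᵇ p (x ∷ xs) f with p x
  ... | true  = cong (f x xor_) (xorSum-filterᵇ p xs f)
  ... | false = xorSum-filterᵇ p xs f

xorSum-allFin-suc : ∀ {n} (f : Fin (suc n) → Bool) →
  xorSum (allFin (suc n)) f ≡ f zero xor xorSum (allFin n) (f ∘ suc)
xorSum-allFin-suc {n} f =
  cong (f zero xor_) (trans (cong (λ xs → xorSum xs f) (sym (map-tabulate (λ i → i) suc)))
                            (xorSum-map suc (allFin n) f))

⌊≟⌋-injective : ∀ {m n} (f : Fin m → Fin n) → Injective _≡_ _≡_ f → ∀ i j → ⌊ f i ≟ f j ⌋ ≡ ⌊ i ≟ j ⌋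
⌊≟⌋-injective f f-inj i j =
  trans (isYes≗does (f i ≟ f j))
        (trans (does-⇔ (mk⇔ f-inj (cong f)) (f i ≟ f j) (i ≟ j)) (sym (isYes≗does (i ≟ j))))

xorSum-allFin-δ : ∀ {n} (f : Fin n → Bool) q → xorSum (allFin n) (λ β → f β ∧ ⌊ q ≟ β ⌋) ≡ f q
xorSum-allFin-δ {suc n} f zero = begin
    xorSum (allFin (suc n)) (λ β → f β ∧ ⌊ zero ≟ β ⌋)
  ≡⟨ xorSum-allFin-suc (λ β → f β ∧ ⌊ zero ≟ β ⌋) ⟩
    (f zero ∧ true) xor xorSum (allFin n) (λ β → f (suc β) ∧ false)
  ≡⟨ cong₂ _xor_ (∧-identityʳ (f zero)) (xorSum-false (allFin n) (λ β → ∧-zeroʳ (f (suc β)))) ⟩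
    f zero xor false
  ≡⟨ xor-identityʳ (f zero) ⟩
    f zero
  ∎ where open ≡-Reasoning
xorSum-allFin-δ {suc n} f (suc q) = begin
    xorSum (allFin (suc n)) (λ β → f β ∧ ⌊ suc q ≟ β ⌋)
  ≡⟨ xorSum-allFin-suc (λ β → f β ∧ ⌊ suc q ≟ β ⌋) ⟩
    (f zero ∧ false) xor xorSum (allFin n) (λ β → f (suc β) ∧ ⌊ suc q ≟ suc β ⌋)
  ≡⟨ cong₂ _xor_ (∧-zeroʳ (f zero))
       (xorSum-cong (allFin n) (λ β → cong (f (suc β) ∧_) (⌊≟⌋-injective suc suc-injective q β))) ⟩
    xorSum (allFin n) (λ β → f (suc β) ∧ ⌊ q ≟ β ⌋)
  ≡⟨ xorSum-allFin-δ (f ∘ suc) q ⟩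
    f (suc q)
  ∎ where open ≡-Reasoning

pairHits : ∀ {k} → Fin k × Fin k → Fin k → Fin k → Bool
pairHits (i , j) p q = (⌊ p ≟ i ⌋ ∧ ⌊ q ≟ j ⌋) ∨ (⌊ q ≟ i ⌋ ∧ ⌊ p ≟ j ⌋)

toggles : ∀ {k} → List (Fin k × Fin k) → Fin k → Fin k → Bool
toggles ps p q = xorSum ps (λ ij → pairHits ij p q)

toggles-sym : ∀ {k} (ps : List (Fin k × Fin k)) p q → toggles ps p q ≡ toggles ps q p
toggles-sym ps p q = xorSum-cong ps (λ { (i , j) → ∨-comm (⌊ p ≟ i ⌋ ∧ ⌊ q ≟ j ⌋) _ })

relabel : ∀ {k k′} → (Fin k → Fin k′) → List (Fin k × Fin k) → List (Fin k′ × Fin k′)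
relabel f = map (Product.map f f)

toggles-relabel : ∀ {k k′} {f : Fin k → Fin k′} → Injective _≡_ _≡_ f →
  ∀ ps p q → toggles (relabel f ps) (f p) (f q) ≡ toggles ps p q
toggles-relabel {f = f} f-inj ps p q =
  trans (xorSum-map (Product.map f f) ps _) (xorSum-cong ps λ { (i , j) →
    cong₂ _∨_ (cong₂ _∧_ (f≟f p i) (f≟f q j)) (cong₂ _∧_ (f≟f q i) (f≟f p j)) })
  where f≟f = ⌊≟⌋-injective f f-inj

toggles-relabel-suc-zero : ∀ {k} (ps : List (Fin k × Fin k)) q → toggles (relabel suc ps) zero q ≡ false
toggles-relabel-suc-zero ps q =
  trans (xorSum-map (Product.map suc suc) ps _) (xorSum-false ps λ { (i , j) → ∧-zeroʳ ⌊ q ≟ suc i ⌋ })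

realise : ∀ M → (Fin M → Fin M → Bool) → List (Fin M × Fin M)
realise zero    T = []
realise (suc M) T = map (zero ,_) (filterᵇ (T zero) (allFin (suc M)))
                 ++ relabel suc (realise M (λ α β → T (suc α) (suc β)))

toggles-row-zero : ∀ {M} (f : Fin (suc M) → Bool) q →
  toggles (map (zero ,_) (filterᵇ f (allFin (suc M)))) zero q ≡ f q
toggles-row-zero f q = begin
    toggles (map (zero ,_) (filterᵇ f (allFin _))) zero q
  ≡⟨ xorSum-map (zero ,_) (filterᵇ f (allFin _)) _ ⟩
    xorSum (filterᵇ f (allFin _)) (λ β → pairHits (zero , β) zero q)
  ≡⟨ xorSum-filterᵇ f (allFin _) _ ⟩
    xorSum (allFin _) (λ β → f β ∧ pairHits (zero , β) zero q)
  ≡⟨ xorSum-cong (allFin _) (λ β → cong (f β ∧_) (pairHits-zero q β)) ⟩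
    xorSum (allFin _) (λ β → f β ∧ ⌊ q ≟ β ⌋)
  ≡⟨ xorSum-allFin-δ f q ⟩
    f q
  ∎
  where
  open ≡-Reasoning
  pairHits-zero : ∀ {M} (q β : Fin (suc M)) → pairHits (zero , β) zero q ≡ ⌊ q ≟ β ⌋
  pairHits-zero zero    β = ∨-idem ⌊ zero ≟ β ⌋
  pairHits-zero (suc q) β = ∨-identityʳ ⌊ suc q ≟ β ⌋

toggles-realise-zero : ∀ M (T : Fin (suc M) → Fin (suc M) → Bool) q →
  toggles (realise (suc M) T) zero q ≡ T zero q
toggles-realise-zero M T q = begin
    toggles (row ++ rest) zero q
  ≡⟨ xorSum-++ row rest _ ⟩
    toggles row zero q xor toggles rest zero q
  ≡⟨ cong₂ _xor_ (toggles-row-zero (T zero) q) (toggles-relabel-suc-zero (realise M _) q) ⟩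
    T zero q xor false
  ≡⟨ xor-identityʳ (T zero q) ⟩
    T zero q
  ∎
  where
  open ≡-Reasoning
  row  = map (zero ,_) (filterᵇ (T zero) (allFin (suc M)))
  rest = relabel suc (realise M (λ α β → T (suc α) (suc β)))

toggles-realise : ∀ M (T : Fin M → Fin M → Bool) → (∀ α β → T α β ≡ T β α) →
  ∀ p q → toggles (realise M T) p q ≡ T p q
toggles-realise (suc M) T T-sym zero    q       = toggles-realise-zero M T q
toggles-realise (suc M) T T-sym (suc a) zero    =
  trans (toggles-sym (realise (suc M) T) (suc a) zero)
        (trans (toggles-realise-zero M T (suc a)) (T-sym zero (suc a)))
toggles-realise (suc M) T T-sym (suc a) (suc b) = begin
    toggles (row ++ rest) (suc a) (suc b)
  ≡⟨ xorSum-++ row rest _ ⟩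
    toggles row (suc a) (suc b) xor toggles rest (suc a) (suc b)
  ≡⟨ cong₂ _xor_ row-misses (toggles-relabel suc-injective (realise M T₊) a b) ⟩
    toggles (realise M T₊) a b
  ≡⟨ toggles-realise M T₊ (λ α β → T-sym (suc α) (suc β)) a b ⟩
    T (suc a) (suc b)
  ∎
  where
  open ≡-Reasoning
  T₊ : Fin M → Fin M → Bool
  T₊ α β = T (suc α) (suc β)
  row  = map (zero ,_) (filterᵇ (T zero) (allFin (suc M)))
  rest = relabel suc (realise M T₊)
  row-misses : toggles row (suc a) (suc b) ≡ false
  row-misses = trans (xorSum-map (zero ,_) (filterᵇ (T zero) (allFin (suc M))) _)
                     (xorSum-false (filterᵇ (T zero) (allFin (suc M))) (λ _ → refl))

flipWith : ∀ {N} → (Fin N → Fin N → Bool) → Adj N → Adj N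
flipWith t a u v = a u v xor (not ⌊ u ≟ v ⌋ ∧ t u v)

flipWith-flipWith : ∀ {N} (s t : Fin N → Fin N → Bool) a u v →
  flipWith t (flipWith s a) u v ≡ flipWith (λ x y → s x y xor t x y) a u v
flipWith-flipWith s t a u v = xor-∧-merge (a u v) (not ⌊ u ≟ v ⌋) (s u v) (t u v)

flipAdj-flipWith : ∀ {N k} (part : Fin N → Fin k) ps a u v →
  flipAdj part ps a u v ≡ flipWith (λ x y → toggles ps (part x) (part y)) a u v
flipAdj-flipWith part []       a u v =
  sym (trans (cong (a u v xor_) (∧-zeroʳ (not ⌊ u ≟ v ⌋))) (xor-identityʳ (a u v)))
flipAdj-flipWith part (ij ∷ ps) a u v = begin
    flipAdj part ps a u v xor (c ∧ hit)
  ≡⟨ cong (_xor (c ∧ hit)) (flipAdj-flipWith part ps a u v) ⟩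
    (a u v xor (c ∧ rest)) xor (c ∧ hit)
  ≡⟨ xor-∧-merge (a u v) c rest hit ⟩
    a u v xor (c ∧ (rest xor hit))
  ≡⟨ cong (λ z → a u v xor (c ∧ z)) (xor-comm rest hit) ⟩
    a u v xor (c ∧ (hit xor rest))
  ∎
  where
  open ≡-Reasoning
  c    = not ⌊ u ≟ v ⌋
  hit  = pairHits ij (part u) (part v)
  rest = toggles ps (part u) (part v)

flipAdj-cong : ∀ {N k} (part : Fin N → Fin k) ps {a b : Adj N} → (∀ u v → a u v ≡ b u v) →
  ∀ u v → flipAdj part ps a u v ≡ flipAdj part ps b u v
flipAdj-cong part []        a≗b u v = a≗b u v
flipAdj-cong part (ij ∷ ps) a≗b u v = cong (_xor _) (flipAdj-cong part ps a≗b u v)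

flipAdj-relabel : ∀ {N k k′} {f : Fin k → Fin k′} → Injective _≡_ _≡_ f →
  ∀ (part : Fin N → Fin k) ps a u v → flipAdj part ps a u v ≡ flipAdj (f ∘ part) (relabel f ps) a u v
flipAdj-relabel {f = f} f-inj part ps a u v =
  trans (flipAdj-flipWith part ps a u v)
        (trans (cong (λ z → a u v xor (not ⌊ u ≟ v ⌋ ∧ z))
                     (sym (toggles-relabel f-inj ps (part u) (part v))))
               (sym (flipAdj-flipWith (f ∘ part) (relabel f ps) a u v)))

flipAdj-relative : ∀ {N k k′} (part₁ : Fin N → Fin k) ps₁ (part : Fin N → Fin k′) ps →
  Σ (Fin N → Fin (k * k′)) λ P → Σ (List (Fin (k * k′) × Fin (k * k′))) λ Q →
  ∀ a u v → flipAdj P Q (flipAdj part ps a) u v ≡ flipAdj part₁ ps₁ a u v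
flipAdj-relative {N} {k} {k′} part₁ ps₁ part ps = P , Q , flip-eq
  where
  P : Fin N → Fin (k * k′)
  P u = combine (part₁ u) (part u)
  G : Fin k × Fin k′ → Fin k × Fin k′ → Bool
  G x y = toggles ps (proj₂ x) (proj₂ y) xor toggles ps₁ (proj₁ x) (proj₁ y)
  T : Fin (k * k′) → Fin (k * k′) → Bool
  T α β = G (remQuot {k} k′ α) (remQuot {k} k′ β)
  T-sym : ∀ α β → T α β ≡ T β α
  T-sym α β = cong₂ _xor_ (toggles-sym ps (proj₂ (remQuot {k} k′ α)) (proj₂ (remQuot {k} k′ β)))
                          (toggles-sym ps₁ (proj₁ (remQuot {k} k′ α)) (proj₁ (remQuot {k} k′ β)))
  -- Flipping Q on the refined parts undoes the k′-flip and performs the k-flip.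
  Q = realise (k * k′) T
  t t₁ : Fin N → Fin N → Bool
  t  u v = toggles ps (part u) (part v)
  t₁ u v = toggles ps₁ (part₁ u) (part₁ v)
  toggles-Q : ∀ u v → toggles Q (P u) (P v) ≡ t u v xor t₁ u v
  toggles-Q u v = trans (toggles-realise (k * k′) T T-sym (P u) (P v))
    (cong₂ G (remQuot-combine (part₁ u) (part u)) (remQuot-combine (part₁ v) (part v)))
  flip-eq : ∀ a u v → flipAdj P Q (flipAdj part ps a) u v ≡ flipAdj part₁ ps₁ a u v
  flip-eq a u v = begin
      flipAdj P Q (flipAdj part ps a) u v
    ≡⟨ flipAdj-flipWith P Q (flipAdj part ps a) u v ⟩
      flipWith tQ (flipAdj part ps a) u v
    ≡⟨ cong (_xor (c ∧ tQ u v)) (flipAdj-flipWith part ps a u v) ⟩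
      flipWith tQ (flipWith t a) u v
    ≡⟨ flipWith-flipWith t tQ a u v ⟩
      a u v xor (c ∧ (t u v xor tQ u v))
    ≡⟨ cong (λ z → a u v xor (c ∧ (t u v xor z))) (toggles-Q u v) ⟩
      a u v xor (c ∧ (t u v xor (t u v xor t₁ u v)))
    ≡⟨ cong (λ z → a u v xor (c ∧ z)) (xor-cancelˡ (t u v) (t₁ u v)) ⟩
      flipWith t₁ a u v
    ≡⟨ sym (flipAdj-flipWith part₁ ps₁ a u v) ⟩
      flipAdj part₁ ps₁ a u v
    ∎
    where
    open ≡-Reasoning
    c = not ⌊ u ≟ v ⌋
    tQ : Fin N → Fin N → Bool
    tQ x y = toggles Q (P x) (P y)

record _≅_ {N} (H H′ : SGraph N) : Set where
  field
    to    : ∀ {v} → mem H v → mem H′ v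
    from  : ∀ {v} → mem H′ v → mem H v
    adj-≡ : ∀ u v → adj H u v ≡ adj H′ u v
open _≅_

≅-sym : ∀ {N} {H H′ : SGraph N} → H ≅ H′ → H′ ≅ H
≅-sym H≅H′ = record { to = from H≅H′ ; from = to H≅H′ ; adj-≡ = λ u v → sym (adj-≡ H≅H′ u v) }

≅-adj : ∀ {N} (V : Fin N → Set) {a b : Adj N} → (∀ u v → a u v ≡ b u v) → sgraph V a ≅ sgraph V b
≅-adj V a≗b = record { to = λ x → x ; from = λ x → x ; adj-≡ = a≗b }

≅-walk : ∀ {N} {H H′ : SGraph N} → H ≅ H′ → ∀ {u w l} → Walk H u w l → Walk H′ u w l
≅-walk H≅H′ (nil u∈H) = nil (to H≅H′ u∈H)
≅-walk H≅H′ {u} (cons {w = w} u∈H uw W) =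
  cons (to H≅H′ u∈H) (trans (sym (adj-≡ H≅H′ u w)) uw) (≅-walk H≅H′ W)

ball-cong : ∀ {N} r {H H′ : SGraph N} → H ≅ H′ → ∀ v → ball r H v ≅ ball r H′ v
ball-cong r H≅H′ v = record
  { to    = λ { (l , W , l≤r) → l , ≅-walk H≅H′ W , l≤r }
  ; from  = λ { (l , W , l≤r) → l , ≅-walk (≅-sym H≅H′) W , l≤r }
  ; adj-≡ = adj-≡ H≅H′
  }

flipG-cong : ∀ {N k} (part : Fin N → Fin k) ps {H H′ : SGraph N} →
  H ≅ H′ → flipG part ps H ≅ flipG part ps H′
flipG-cong part ps H≅H′ = record
  { to = to H≅H′ ; from = from H≅H′ ; adj-≡ = flipAdj-cong part ps (adj-≡ H≅H′) }

FrkLe-resp-≅ : ∀ {r k n N} {H H′ : SGraph N} → H ≅ H′ → FrkLe r k n H → FrkLe r k n H′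
FrkLe-resp-≅ H≅H′ (base (v , v∈H , unique)) =
  base (v , to H≅H′ v∈H , λ u u∈H′ → unique u (from H≅H′ u∈H′))
FrkLe-resp-≅ {r} H≅H′ (step part ps balls) =
  step part ps λ v v∈H′ →
    FrkLe-resp-≅ (ball-cong r (flipG-cong part ps H≅H′) v) (balls v (from H≅H′ v∈H′))

FrkLe-relabel : ∀ {r k k′ n N} {H : SGraph N} (f : Fin k → Fin k′) → Injective _≡_ _≡_ f →
  FrkLe r k n H → FrkLe r k′ n H
FrkLe-relabel f f-inj (base K₁) = base K₁
FrkLe-relabel {r} {H = H} f f-inj (step part ps balls) =
  step (f ∘ part) (relabel f ps) λ v v∈H →
    FrkLe-resp-≅ (ball-cong r (≅-adj (mem H) (flipAdj-relabel f-inj part ps (adj H))) v)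
                 (FrkLe-relabel f f-inj (balls v v∈H))

-- A vertex of G provides a part of G′, so that Fin k embeds into the refined parts Fin (k * k′).
lemma4p9 : (r : ℕ∞) (k k′ N : ℕ) (a : Adj N) → IsSimple a →
    (part : Fin N → Fin k′) (ps : List (Fin k′ × Fin k′)) →
    ∀ (m : ℕ) → FrkLe r k m (full a) → FrkLe r (k * k′) m (full (flipAdj part ps a))
lemma4p9 r k k′ zero    a _ part ps m (base (() , _))
lemma4p9 r k k′ zero    a _ part ps m (step _ _ _) = step (λ ()) [] (λ ())
lemma4p9 r k k′ (suc N) a _ part ps m (base K₁)    = base K₁
lemma4p9 r k k′ (suc N) a _ part ps m (step part₁ ps₁ balls)
  with P , Q , flip-eq ← flipAdj-relative part₁ ps₁ part ps =
  step P Q λ v _ →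
    FrkLe-resp-≅ (ball-cong r (≅-adj _ (λ u w → sym (flip-eq a u w))) v)
                 (FrkLe-relabel (λ i → combine i (part zero)) (combine-injectiveˡ _ _ _ _) (balls v tt))
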